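{- Let $\mathcal{F}_3$ be the set of triples of non-negative integers, identified up to permutation, satisfying $(x_1+x_2+x_3)^2-(x_1+x_2+x_3)-4(x_1x_2+x_1x_3+x_2x_3)=0$ (the 3-color fair games), with two elements adjacent if (for suitable orderings) they differ in exactly one coordinate. Call a game non-trivial if $x_1+x_2+x_3\ge 2$. Then the induced graph on the non-trivial 3-color fair games is an infinite full binary tree with root $(0,1,3)$: it is a tree, every vertex has exactly two children, where the children of a vertex are its neighbors of greater height $\left|1+x_1+x_2+x_3\right|$, and every vertex other than $(0,1,3)$ has exactly one neighbor of smaller height while $(0,1,3)$ has none in this graph. -}

module Defs where

open import Data.Nat using (ℕ; zero; suc; _+_; _*_; _≤_; _<_)
open import Data.Product using (Σ; ∃; ∃-syntax; _×_; _,_; proj₁; proj₂)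
open import Data.Sum using (_⊎_)
open import Data.List using (List; []; _∷_; length; _∷ʳ_)
open import Data.List.Relation.Unary.AllPairs using (AllPairs)
open import Data.List.Relation.Unary.Linked using (Linked)
open import Relation.Nullary using (¬_)
open import Relation.Binary.PropositionalEquality using (_≡_; _≢_)
open import Relation.Binary.Construct.Closure.ReflexiveTransitive using (Star)

record Triple : Set where
  constructor ⟨_,_,_⟩
  field
    x₁ x₂ x₃ : ℕ
open Triple public

tsum : Triple → ℕ
tsum t = x₁ t + x₂ t + x₃ t

e₂ : Triple → ℕ
e₂ t = x₁ t * x₂ t + x₁ t * x₃ t + x₂ t * x₃ t

-- The fair-game equation  s² - s - 4 e₂ = 0 ,  written over ℕ as  s² = s + 4 e₂
-- (equivalent, since all quantities are natural numbers).
FairEq : Triple → Set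
FairEq t = tsum t * tsum t ≡ s + 4 * e₂ t
  where s = tsum t

height : Triple → ℕ
height t = 1 + tsum t

data Perm : Triple → Triple → Set where
  p123 : ∀ {a b c} → Perm ⟨ a , b , c ⟩ ⟨ a , b , c ⟩
  p132 : ∀ {a b c} → Perm ⟨ a , b , c ⟩ ⟨ a , c , b ⟩
  p213 : ∀ {a b c} → Perm ⟨ a , b , c ⟩ ⟨ b , a , c ⟩
  p231 : ∀ {a b c} → Perm ⟨ a , b , c ⟩ ⟨ b , c , a ⟩
  p312 : ∀ {a b c} → Perm ⟨ a , b , c ⟩ ⟨ c , a , b ⟩
  p321 : ∀ {a b c} → Perm ⟨ a , b , c ⟩ ⟨ c , b , a ⟩

DiffOne : Triple → Triple → Set
DiffOne s t =
    (x₁ s ≢ x₁ t × x₂ s ≡ x₂ t × x₃ s ≡ x₃ t)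
  ⊎ (x₁ s ≡ x₁ t × x₂ s ≢ x₂ t × x₃ s ≡ x₃ t)
  ⊎ (x₁ s ≡ x₁ t × x₂ s ≡ x₂ t × x₃ s ≢ x₃ t)

TAdj : Triple → Triple → Set
TAdj s t = ∃[ u ] (Perm t u × DiffOne s u)

-- Triples up to permutation are represented by their sorted representative
-- x₁ ≤ x₂ ≤ x₃.
Sorted : Triple → Set
Sorted t = x₁ t ≤ x₂ t × x₂ t ≤ x₃ t

record Game : Set where
  constructor game
  field
    triple     : Triple
    sorted     : Sorted triple
    fair       : FairEq triple
    nontrivial : 2 ≤ tsum triple
open Game public

_≐_ : Game → Game → Set
g ≐ h = triple g ≡ triple h

Adj : Game → Game → Set
Adj g h = TAdj (triple g) (triple h)

hgt : Game → ℕ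
hgt g = height (triple g)

IsChild : Game → Game → Set
IsChild g c = Adj g c × hgt g < hgt c

IsParent : Game → Game → Set
IsParent g p = Adj g p × hgt p < hgt g

Connected : Set
Connected = ∀ g h → Star Adj g h

-- A cycle: vertices v ∷ vs, at least 3 of them, pairwise distinct,
-- consecutive ones adjacent and the last adjacent to v.
IsCycle : Game → List Game → Set
IsCycle v vs = 2 ≤ length vs
             × AllPairs (λ a b → ¬ (a ≐ b)) (v ∷ vs)
             × Linked Adj ((v ∷ vs) ∷ʳ v)

Acyclic : Set
Acyclic = ∀ v vs → ¬ IsCycle v vs

IsTree : Set
IsTree = Connected × Acyclic

root-triple : Triple
root-triple = ⟨ 0 , 1 , 3 ⟩

-- Fixing two coordinates u, v of a fair triple, the third is a root of the quadratic
-- X² − (2(u+v)+1) X + (u+v)² − (u+v) − 4uv, so the neighbours of a game are exactly its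
-- three Vieta jumps x ↦ 2(u+v)+1 − x, and jumping x turns the sum s into 3s + 1 − 4x.
-- A sorted non-trivial game has a < b and a + b < c, so jumping a or b raises the height
-- while jumping c lowers it: every vertex has two children and at most one parent, and
-- the parent exists unless the game is (0,1,3). In a graph graded by a height in which
-- every vertex has at most one lower neighbour, a walk without backtracking never turns
-- down after going up, which rules out cycles; descending along parents reaches the root.

module Submission where

open import Defs
open import Data.Nat using (ℕ; suc; _+_; _*_; _∸_; _≤_; _<_; z≤n; s≤s; _≤?_)
open import Data.Nat.Properties
open import Data.Nat.Induction using (<-wellFounded)
open import Data.Nat.Tactic.RingSolver using (solve)
open import Data.Product using (∃; ∃-syntax; _×_; _,_; proj₂)
open import Data.Sum using (_⊎_; inj₁; inj₂; [_,_]′)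
open import Data.Empty using (⊥; ⊥-elim)
open import Data.Unit using (⊤; tt)
open import Data.List using (List; []; _∷_; _∷ʳ_; length; initLast; _∷ʳ′_)
open import Function using (_on_; _∘′_)
open import Function.Bundles using (_⇔_; mk⇔; Equivalence)
open import Induction.WellFounded using (Acc; acc)
open import Relation.Nullary using (¬_; yes; no)
open import Relation.Binary.PropositionalEquality
open import Relation.Binary.Definitions using (tri<; tri≈; tri>)
open import Relation.Binary.Construct.Closure.ReflexiveTransitive as Star
  using (Star; ε; _◅_; _◅◅_)

open Equivalence using (to; from)

-- Graphs graded by a height

module Graded {V : Set} (_~_ : V → V → Set) (h : V → ℕ) (~-sym : ∀ {x y} → x ~ y → y ~ x) where

  open import Data.List.Relation.Unary.All as All using (All; []; _∷_)
  open import Data.List.Relation.Unary.All.Properties using (∷ʳ⁻)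
  open import Data.List.Relation.Unary.AllPairs using (AllPairs; []; _∷_)
  open import Data.List.Relation.Unary.Linked as Linked using (Linked; []; [-]; _∷_)
  open import Data.List.Relation.Unary.Linked.Properties using (Linked⇒All)

  Linked-last : ∀ {R : V → V → Set} xs {y z} → Linked R ((xs ∷ʳ y) ∷ʳ z) → R y z
  Linked-last []       (r ∷ [-]) = r
  Linked-last (_ ∷ xs) walk      = Linked-last xs (Linked.tail walk)

  LowerNeighbour : V → V → Set
  LowerNeighbour x y = x ~ y × h y < h x

  module Connectivity (root : V) (descend : ∀ x → x ≡ root ⊎ ∃ (LowerNeighbour x)) where

    path-to-root : ∀ x → Star _~_ x root
    path-to-root x = go x (<-wellFounded (h x))
      where
      go : ∀ x → Acc _<_ (h x) → Star _~_ x root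
      go x (acc rs) with descend x
      ... | inj₁ refl             = ε
      ... | inj₂ (y , x~y , y<x) = x~y ◅ go y (rs y<x)

    connected : ∀ x y → Star _~_ x y
    connected x y = path-to-root x ◅◅ Star.reverse ~-sym (path-to-root y)

  module Acyclicity
    (_≈_ : V → V → Set) (≈-sym : ∀ {x y} → x ≈ y → y ≈ x)
    (~-changes-height : ∀ {x y} → x ~ y → h x < h y ⊎ h y < h x)
    (lowerNeighbour-unique : ∀ {x y z} → LowerNeighbour x y → LowerNeighbour x z → y ≈ z)
    where

    _≉_ : V → V → Set
    x ≉ y = ¬ x ≈ y

    NonBacktracking : List V → Set
    NonBacktracking (x ∷ y ∷ z ∷ zs) = x ≉ z × NonBacktracking (y ∷ z ∷ zs)
    NonBacktracking _                = ⊤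

    NonBacktracking-tail : ∀ {x xs} → NonBacktracking (x ∷ xs) → NonBacktracking xs
    NonBacktracking-tail {xs = []}        _        = tt
    NonBacktracking-tail {xs = _ ∷ []}    _        = tt
    NonBacktracking-tail {xs = _ ∷ _ ∷ _} (_ , nb) = nb

    nonBacktracking-∷ʳ : ∀ {xs z} → AllPairs _≉_ xs → All (_≉ z) xs → NonBacktracking (xs ∷ʳ z)
    nonBacktracking-∷ʳ []                 []        = tt
    nonBacktracking-∷ʳ (_ ∷ [])           _         = tt
    nonBacktracking-∷ʳ (_ ∷ _ ∷ [])       (x≉z ∷ _) = x≉z , tt
    nonBacktracking-∷ʳ ((_ ∷ x≉w ∷ _) ∷ distinct@(_ ∷ _ ∷ _)) (_ ∷ ≉z) =
      x≉w , nonBacktracking-∷ʳ distinct ≉z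

    cycle-nonBacktracking : ∀ {v vs} → 2 ≤ length vs → AllPairs _≉_ (v ∷ vs) →
                            NonBacktracking ((v ∷ vs) ∷ʳ v)
    cycle-nonBacktracking {vs = []}        ()       _
    cycle-nonBacktracking {vs = _ ∷ []}    (s≤s ()) _
    cycle-nonBacktracking {vs = _ ∷ _ ∷ _} _        (v≉vs@(_ ∷ v≉w₂ ∷ _) ∷ distinct) =
      v≉w₂ , nonBacktracking-∷ʳ distinct (All.map (λ v≉w w≈v → v≉w (≈-sym w≈v)) v≉vs)

    -- A downward step right after an upward one would make both ends of the two
    -- steps lower neighbours of the middle vertex.
    rises : ∀ {x y ys} → Linked _~_ (x ∷ y ∷ ys) → NonBacktracking (x ∷ y ∷ ys) → h x < h y →
            Linked (_<_ on h) (x ∷ y ∷ ys)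
    rises (_ ∷ [-])            _          x<y = x<y ∷ [-]
    rises (x~y ∷ y~z ∷ walk) (x≉z , nb) x<y with ~-changes-height y~z
    ... | inj₁ y<z = x<y ∷ rises (y~z ∷ walk) nb y<z
    ... | inj₂ z<y = ⊥-elim (x≉z (lowerNeighbour-unique (~-sym x~y , x<y) (y~z , z<y)))

    arrives-from-below : ∀ x us {y z} → Linked _~_ (((x ∷ us) ∷ʳ y) ∷ʳ z) →
                         NonBacktracking (((x ∷ us) ∷ʳ y) ∷ʳ z) → h x < h z → LowerNeighbour z y
    arrives-from-below x [] walk@(x~y ∷ _) nb x<z with ~-changes-height x~y
    ... | inj₁ x<y = ~-sym (Linked-last (x ∷ []) walk) , Linked-last (x ∷ []) (rises walk nb x<y)
    ... | inj₂ y<x = ~-sym (Linked-last (x ∷ []) walk) , <-trans y<x x<z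
    arrives-from-below x (u ∷ us) walk@(x~u ∷ walk′) nb x<z with ~-changes-height x~u
    ... | inj₁ x<u = ~-sym (Linked-last (x ∷ u ∷ us) walk) , Linked-last (x ∷ u ∷ us) (rises walk nb x<u)
    ... | inj₂ u<x = arrives-from-below u us walk′ (NonBacktracking-tail nb) (<-trans u<x x<z)

    -- A cycle starting upwards would rise forever; starting downwards, it returns to v
    -- from below, giving v two distinct lower neighbours.
    no-cycle : ∀ {v vs} → 2 ≤ length vs → AllPairs _≉_ (v ∷ vs) → Linked _~_ ((v ∷ vs) ∷ʳ v) → ⊥
    no-cycle {v} {w ∷ ws} len distinct@(_ ∷ w≉ws ∷ _) walk@(v~w ∷ walk′) with ~-changes-height v~w
    ... | inj₁ v<w =
      <-irrefl refl (proj₂ (∷ʳ⁻ {xs = w ∷ ws} (Linked⇒All <-trans v<w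
        (Linked.tail (rises walk (cycle-nonBacktracking len distinct) v<w)))))
    ... | inj₂ w<v with initLast ws | len
    ...   | []       | s≤s ()
    ...   | us ∷ʳ′ u | _ =
      proj₂ (∷ʳ⁻ w≉ws) (lowerNeighbour-unique (v~w , w<v)
        (arrives-from-below w us walk′ (NonBacktracking-tail (cycle-nonBacktracking len distinct)) w<v))

-- Vieta's formulas over ℕ

other-root : ∀ {m Q R x y} → x * x + Q ≡ x * m + R → y + x ≡ m → y * y + Q ≡ y * m + R
other-root {Q = Q} {R} {x} {y} e refl = +-cancelʳ-≡ (x * x) _ _ (begin
  (y * y + Q) + x * x        ≡⟨ solve (x ∷ y ∷ Q ∷ []) ⟩
  y * y + (x * x + Q)        ≡⟨ cong (y * y +_) e ⟩
  y * y + (x * (y + x) + R)  ≡⟨ solve (x ∷ y ∷ R ∷ []) ⟩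
  (y * (y + x) + R) + x * x  ∎)
  where open ≡-Reasoning

roots-sum-< : ∀ {m Q R x y} → x * x + Q ≡ x * m + R → y * y + Q ≡ y * m + R → x < y → y + x ≡ m
roots-sum-< {m} {Q} {R} {x} e₁ e₂ x<y with m≤n⇒∃[o]m+o≡n x<y
... | k , refl = *-cancelˡ-≡ _ m (suc k) (+-cancelˡ-≡ (x * m + R) _ _ (begin
  (x * m + R) + suc k * (suc x + k + x)  ≡⟨ cong (_+ suc k * (suc x + k + x)) (sym e₁) ⟩
  (x * x + Q) + suc k * (suc x + k + x)  ≡⟨ solve (x ∷ k ∷ Q ∷ []) ⟩
  (suc x + k) * (suc x + k) + Q          ≡⟨ e₂ ⟩
  (suc x + k) * m + R                    ≡⟨ solve (x ∷ k ∷ m ∷ R ∷ []) ⟩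
  (x * m + R) + suc k * m                ∎))
  where open ≡-Reasoning

roots-sum : ∀ {m Q R x y} → x * x + Q ≡ x * m + R → y * y + Q ≡ y * m + R → x ≢ y → y + x ≡ m
roots-sum {x = x} {y} e₁ e₂ x≢y with <-cmp x y
... | tri< x<y _ _ = roots-sum-< e₁ e₂ x<y
... | tri≈ _ x≡y _ = ⊥-elim (x≢y x≡y)
... | tri> _ _ y<x = trans (+-comm y x) (roots-sum-< e₂ e₁ y<x)

four-mul≤square-sum : ∀ u v → 4 * (u * v) ≤ (u + v) * (u + v)
four-mul≤square-sum u v =
  [ ordered , (λ v≤u → subst₂ (λ p w → 4 * p ≤ w * w) (*-comm v u) (+-comm v u) (ordered v≤u)) ]′
  (≤-total u v)
  where
  ordered : ∀ {u v} → u ≤ v → 4 * (u * v) ≤ (u + v) * (u + v)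
  ordered {u} u≤v with m≤n⇒∃[o]m+o≡n u≤v
  ... | d , refl = subst (4 * (u * (u + d)) ≤_) square (m≤m+n _ (d * d))
    where
    square : 4 * (u * (u + d)) + d * d ≡ (u + (u + d)) * (u + (u + d))
    square = solve (u ∷ d ∷ [])

-- Fair triples as roots of a quadratic

-- FairEq unfolds to an equation between numbers and so hides its triple from unification.
record Fair (t : Triple) : Set where
  constructor mkFair
  field equation : FairEq t
open Fair

-- FairEq ⟨ x , u , v ⟩ with 2x(u+v) cancelled from both sides.
Quadratic : ℕ → ℕ → ℕ → Set
Quadratic x u v = x * x + (u + v) * (u + v) ≡ x * (2 * (u + v) + 1) + (u + v + 4 * (u * v))

fair⇔quadratic : ∀ x u v → Fair ⟨ x , u , v ⟩ ⇔ Quadratic x u v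
fair⇔quadratic x u v = mk⇔
  (λ f → +-cancelʳ-≡ (2 * x * (u + v)) _ _ (trans (sym square-split) (trans (equation f) rhs-split)))
  (λ e → mkFair (trans square-split (trans (cong (_+ 2 * x * (u + v)) e) (sym rhs-split))))
  where
  square-split : (x + u + v) * (x + u + v) ≡ (x * x + (u + v) * (u + v)) + 2 * x * (u + v)
  square-split = solve (x ∷ u ∷ v ∷ [])
  rhs-split : x + u + v + 4 * (x * u + x * v + u * v)
            ≡ (x * (2 * (u + v) + 1) + (u + v + 4 * (u * v))) + 2 * x * (u + v)
  rhs-split = solve (x ∷ u ∷ v ∷ [])

fair⇒root≤ : ∀ {x u v} → Fair ⟨ x , u , v ⟩ → x ≤ 2 * (u + v) + 1
fair⇒root≤ {x} {u} {v} f = ≮⇒≥ λ m<x → <⇒≱ (≤-<-trans u+v≤m m<x) (x≤u+v m<x)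
  where
  open ≤-Reasoning
  u+v≤m : u + v ≤ 2 * (u + v) + 1
  u+v≤m = ≤-trans (m≤m+n (u + v) (u + v + 0)) (m≤m+n _ 1)
  -- x > 2(u+v)+1 makes x² exceed x(2(u+v)+1) by at least x, but the quadratic caps that excess at u + v.
  x≤u+v : 2 * (u + v) + 1 < x → x ≤ u + v
  x≤u+v m<x = +-cancelʳ-≤ (4 * (u * v)) x (u + v) (+-cancelˡ-≤ (x * (2 * (u + v) + 1)) _ _ (begin
    x * (2 * (u + v) + 1) + (x + 4 * (u * v))       ≡⟨ solve (x ∷ u ∷ v ∷ []) ⟩
    x * suc (2 * (u + v) + 1) + 4 * (u * v)
      ≤⟨ +-mono-≤ (*-monoʳ-≤ x m<x) (four-mul≤square-sum u v) ⟩
    x * x + (u + v) * (u + v)                       ≡⟨ to (fair⇔quadratic x u v) f ⟩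
    x * (2 * (u + v) + 1) + (u + v + 4 * (u * v))   ∎))

vieta : ℕ → ℕ → ℕ → ℕ
vieta x u v = 2 * (u + v) + 1 ∸ x

vieta+x : ∀ {x u v} → Fair ⟨ x , u , v ⟩ → vieta x u v + x ≡ 2 * (u + v) + 1
vieta+x {x} {u} {v} f = m∸n+n≡m {2 * (u + v) + 1} {x} (fair⇒root≤ f)

vieta-fair : ∀ {x u v} → Fair ⟨ x , u , v ⟩ → Fair ⟨ vieta x u v , u , v ⟩
vieta-fair {x} {u} {v} f =
  from (fair⇔quadratic (vieta x u v) u v)
       (other-root {x = x} {y = vieta x u v} (to (fair⇔quadratic x u v) f) (vieta+x f))

vieta-unique : ∀ {x y u v} → Fair ⟨ x , u , v ⟩ → Fair ⟨ y , u , v ⟩ → y ≢ x → y ≡ vieta x u v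
vieta-unique {x} {y} {u} {v} f g y≢x = +-cancelʳ-≡ x y _
  (trans (roots-sum (to (fair⇔quadratic x u v) f) (to (fair⇔quadratic y u v) g) (≢-sym y≢x))
         (sym (vieta+x f)))

-- The two roots sum to an odd number.
vieta≢ : ∀ {x u v} → Fair ⟨ x , u , v ⟩ → vieta x u v ≢ x
vieta≢ {x} {u} {v} f y≡x = even≢odd x (u + v) (begin
  2 * x            ≡⟨ solve (x ∷ []) ⟩
  x + x            ≡⟨ cong (_+ x) (sym y≡x) ⟩
  vieta x u v + x  ≡⟨ vieta+x f ⟩
  2 * (u + v) + 1  ≡⟨ +-comm (2 * (u + v)) 1 ⟩
  suc (2 * (u + v)) ∎)
  where open ≡-Reasoning

jumped-sum : ∀ {x y u v} → y + x ≡ 2 * (u + v) + 1 → (y + u + v) + 4 * x ≡ 3 * (x + u + v) + 1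
jumped-sum {x} {y} {u} {v} e = begin
  (y + u + v) + 4 * x                ≡⟨ solve (x ∷ y ∷ u ∷ v ∷ []) ⟩
  (y + x) + (u + v) + 3 * x          ≡⟨ cong (λ n → n + (u + v) + 3 * x) e ⟩
  2 * (u + v) + 1 + (u + v) + 3 * x  ≡⟨ solve (x ∷ u ∷ v ∷ []) ⟩
  3 * (x + u + v) + 1                ∎
  where open ≡-Reasoning

vieta-tsum : ∀ {x u v} → Fair ⟨ x , u , v ⟩ →
             tsum ⟨ vieta x u v , u , v ⟩ + 4 * x ≡ 3 * tsum ⟨ x , u , v ⟩ + 1
vieta-tsum {x} {u} {v} f = jumped-sum {x} {vieta x u v} {u} {v} (vieta+x f)

-- Permutations of triples

perm-sym : ∀ {t u} → Perm t u → Perm u t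
perm-sym p123 = p123
perm-sym p132 = p132
perm-sym p213 = p213
perm-sym p231 = p312
perm-sym p312 = p231
perm-sym p321 = p321

perm-trans : ∀ {t u w} → Perm t u → Perm u w → Perm t w
perm-trans p123 q    = q
perm-trans p    p123 = p
perm-trans p132 p132 = p123
perm-trans p132 p213 = p312
perm-trans p132 p231 = p321
perm-trans p132 p312 = p213
perm-trans p132 p321 = p231
perm-trans p213 p132 = p231
perm-trans p213 p213 = p123
perm-trans p213 p231 = p132
perm-trans p213 p312 = p321
perm-trans p213 p321 = p312
perm-trans p231 p132 = p213
perm-trans p231 p213 = p321
perm-trans p231 p231 = p312
perm-trans p231 p312 = p123
perm-trans p231 p321 = p132
perm-trans p312 p132 = p321
perm-trans p312 p213 = p132
perm-trans p312 p231 = p123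
perm-trans p312 p312 = p231
perm-trans p312 p321 = p213
perm-trans p321 p132 = p312
perm-trans p321 p213 = p231
perm-trans p321 p231 = p213
perm-trans p321 p312 = p132
perm-trans p321 p321 = p123

tsum-perm : ∀ {a b c a′ b′ c′} → Perm ⟨ a , b , c ⟩ ⟨ a′ , b′ , c′ ⟩ → a + b + c ≡ a′ + b′ + c′
tsum-perm p123                 = refl
tsum-perm (p132 {a} {b} {c}) = solve (a ∷ b ∷ c ∷ [])
tsum-perm (p213 {a} {b} {c}) = solve (a ∷ b ∷ c ∷ [])
tsum-perm (p231 {a} {b} {c}) = solve (a ∷ b ∷ c ∷ [])
tsum-perm (p312 {a} {b} {c}) = solve (a ∷ b ∷ c ∷ [])
tsum-perm (p321 {a} {b} {c}) = solve (a ∷ b ∷ c ∷ [])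

e₂-perm : ∀ {a b c a′ b′ c′} → Perm ⟨ a , b , c ⟩ ⟨ a′ , b′ , c′ ⟩ →
          a * b + a * c + b * c ≡ a′ * b′ + a′ * c′ + b′ * c′
e₂-perm p123                 = refl
e₂-perm (p132 {a} {b} {c}) = solve (a ∷ b ∷ c ∷ [])
e₂-perm (p213 {a} {b} {c}) = solve (a ∷ b ∷ c ∷ [])
e₂-perm (p231 {a} {b} {c}) = solve (a ∷ b ∷ c ∷ [])
e₂-perm (p312 {a} {b} {c}) = solve (a ∷ b ∷ c ∷ [])
e₂-perm (p321 {a} {b} {c}) = solve (a ∷ b ∷ c ∷ [])

fair-perm : ∀ {t u} → Perm t u → Fair t → Fair u
fair-perm p (mkFair f) = mkFair (subst₂ (λ s e → s * s ≡ s + 4 * e) (tsum-perm p) (e₂-perm p) f)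

sorted-unique : ∀ {t u} → Perm t u → Sorted t → Sorted u → t ≡ u
sorted-unique p123 _ _ = refl
sorted-unique p132 (_ , b≤c) (_ , c≤b) with ≤-antisym b≤c c≤b
... | refl = refl
sorted-unique p213 (a≤b , _) (b≤a , _) with ≤-antisym a≤b b≤a
... | refl = refl
sorted-unique p231 (a≤b , b≤c) (_ , c≤a)
  with ≤-antisym a≤b (≤-trans b≤c c≤a) | ≤-antisym b≤c (≤-trans c≤a a≤b)
... | refl | refl = refl
sorted-unique p312 (a≤b , b≤c) (c≤a , _)
  with ≤-antisym a≤b (≤-trans b≤c c≤a) | ≤-antisym b≤c (≤-trans c≤a a≤b)
... | refl | refl = refl
sorted-unique p321 (a≤b , b≤c) (c≤b , b≤a) with ≤-antisym a≤b b≤a | ≤-antisym b≤c c≤b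
... | refl | refl = refl

sort : (t : Triple) → ∃[ u ] (Perm t u × Sorted u)
sort ⟨ a , b , c ⟩ with ≤-total a b | ≤-total b c | ≤-total a c
... | inj₁ a≤b | inj₁ b≤c | _        = _ , p123 , (a≤b , b≤c)
... | inj₁ a≤b | inj₂ c≤b | inj₁ a≤c = _ , p132 , (a≤c , c≤b)
... | inj₁ a≤b | inj₂ c≤b | inj₂ c≤a = _ , p312 , (c≤a , a≤b)
... | inj₂ b≤a | inj₁ b≤c | inj₁ a≤c = _ , p213 , (b≤a , a≤c)
... | inj₂ b≤a | inj₁ b≤c | inj₂ c≤a = _ , p231 , (b≤c , c≤a)
... | inj₂ b≤a | inj₂ c≤b | _        = _ , p321 , (c≤b , b≤a)

TAdj-sym : ∀ {s t} → TAdj s t → TAdj t s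
TAdj-sym (_ , p123 , inj₁ (n , e₂ , e₃))         = _ , p123 , inj₁ (≢-sym n , sym e₂ , sym e₃)
TAdj-sym (_ , p123 , inj₂ (inj₁ (e₁ , n , e₃))) = _ , p123 , inj₂ (inj₁ (sym e₁ , ≢-sym n , sym e₃))
TAdj-sym (_ , p123 , inj₂ (inj₂ (e₁ , e₂ , n))) = _ , p123 , inj₂ (inj₂ (sym e₁ , sym e₂ , ≢-sym n))
TAdj-sym (_ , p132 , inj₁ (n , e₂ , e₃))         = _ , p132 , inj₁ (≢-sym n , sym e₃ , sym e₂)
TAdj-sym (_ , p132 , inj₂ (inj₁ (e₁ , n , e₃))) = _ , p132 , inj₂ (inj₂ (sym e₁ , sym e₃ , ≢-sym n))
TAdj-sym (_ , p132 , inj₂ (inj₂ (e₁ , e₂ , n))) = _ , p132 , inj₂ (inj₁ (sym e₁ , ≢-sym n , sym e₂))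
TAdj-sym (_ , p213 , inj₁ (n , e₂ , e₃))         = _ , p213 , inj₂ (inj₁ (sym e₂ , ≢-sym n , sym e₃))
TAdj-sym (_ , p213 , inj₂ (inj₁ (e₁ , n , e₃))) = _ , p213 , inj₁ (≢-sym n , sym e₁ , sym e₃)
TAdj-sym (_ , p213 , inj₂ (inj₂ (e₁ , e₂ , n))) = _ , p213 , inj₂ (inj₂ (sym e₂ , sym e₁ , ≢-sym n))
TAdj-sym (_ , p231 , inj₁ (n , e₂ , e₃))         = _ , p312 , inj₂ (inj₁ (sym e₃ , ≢-sym n , sym e₂))
TAdj-sym (_ , p231 , inj₂ (inj₁ (e₁ , n , e₃))) = _ , p312 , inj₂ (inj₂ (sym e₃ , sym e₁ , ≢-sym n))
TAdj-sym (_ , p231 , inj₂ (inj₂ (e₁ , e₂ , n))) = _ , p312 , inj₁ (≢-sym n , sym e₁ , sym e₂)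
TAdj-sym (_ , p312 , inj₁ (n , e₂ , e₃))         = _ , p231 , inj₂ (inj₂ (sym e₂ , sym e₃ , ≢-sym n))
TAdj-sym (_ , p312 , inj₂ (inj₁ (e₁ , n , e₃))) = _ , p231 , inj₁ (≢-sym n , sym e₃ , sym e₁)
TAdj-sym (_ , p312 , inj₂ (inj₂ (e₁ , e₂ , n))) = _ , p231 , inj₂ (inj₁ (sym e₂ , ≢-sym n , sym e₁))
TAdj-sym (_ , p321 , inj₁ (n , e₂ , e₃))         = _ , p321 , inj₂ (inj₂ (sym e₃ , sym e₂ , ≢-sym n))
TAdj-sym (_ , p321 , inj₂ (inj₁ (e₁ , n , e₃))) = _ , p321 , inj₂ (inj₁ (sym e₃ , ≢-sym n , sym e₁))
TAdj-sym (_ , p321 , inj₂ (inj₂ (e₁ , e₂ , n))) = _ , p321 , inj₁ (≢-sym n , sym e₂ , sym e₁)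

-- Jumps

data Coordinate : Set where
  first second third : Coordinate

coordinate : Coordinate → Triple → ℕ
coordinate first  = x₁
coordinate second = x₂
coordinate third  = x₃

jump : Coordinate → Triple → Triple
jump first  ⟨ a , b , c ⟩ = ⟨ vieta a b c , b , c ⟩
jump second ⟨ a , b , c ⟩ = ⟨ a , vieta b a c , c ⟩
jump third  ⟨ a , b , c ⟩ = ⟨ a , b , vieta c a b ⟩

jump-fair : ∀ i {t} → Fair t → Fair (jump i t)
jump-fair first  f = vieta-fair f
jump-fair second f = fair-perm p213 (vieta-fair (fair-perm p213 f))
jump-fair third  f = fair-perm p231 (vieta-fair (fair-perm p312 f))

jump-tsum : ∀ i {t} → Fair t → tsum (jump i t) + 4 * coordinate i t ≡ 3 * tsum t + 1
jump-tsum first  f = vieta-tsum f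
jump-tsum second {⟨ a , b , c ⟩} f =
  subst₂ (λ T s → T + 4 * b ≡ 3 * s + 1) (tsum-perm (p213 {vieta b a c})) (tsum-perm (p213 {b}))
         (vieta-tsum (fair-perm p213 f))
jump-tsum third  {⟨ a , b , c ⟩} f =
  subst₂ (λ T s → T + 4 * c ≡ 3 * s + 1) (tsum-perm (p231 {vieta c a b})) (tsum-perm (p231 {c}))
         (vieta-tsum (fair-perm p312 f))

jump-DiffOne : ∀ i {t} → Fair t → DiffOne t (jump i t)
jump-DiffOne first  f = inj₁ (≢-sym (vieta≢ f) , refl , refl)
jump-DiffOne second f = inj₂ (inj₁ (refl , ≢-sym (vieta≢ (fair-perm p213 f)) , refl))
jump-DiffOne third  f = inj₂ (inj₂ (refl , refl , ≢-sym (vieta≢ (fair-perm p312 f))))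

DiffOne⇒jump : ∀ {t u} → Fair t → Fair u → DiffOne t u → ∃[ i ] u ≡ jump i t
DiffOne⇒jump f g (inj₁ (a≢y , refl , refl)) =
  first , cong (λ y → ⟨ y , _ , _ ⟩) (vieta-unique f g (≢-sym a≢y))
DiffOne⇒jump f g (inj₂ (inj₁ (refl , b≢y , refl))) =
  second , cong (λ y → ⟨ _ , y , _ ⟩) (vieta-unique (fair-perm p213 f) (fair-perm p213 g) (≢-sym b≢y))
DiffOne⇒jump f g (inj₂ (inj₂ (refl , refl , c≢y))) =
  third , cong (λ y → ⟨ _ , _ , y ⟩) (vieta-unique (fair-perm p312 f) (fair-perm p312 g) (≢-sym c≢y))

jump-raises : ∀ {T} x s → T + 4 * x ≡ 3 * s + 1 → x + x ≤ s → s < T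
jump-raises {T} x s e x+x≤s = +-cancelʳ-≤ (2 * s) (suc s) T (begin
  suc s + 2 * s     ≡⟨ solve (s ∷ []) ⟩
  3 * s + 1         ≡⟨ sym e ⟩
  T + 4 * x         ≡⟨ solve (T ∷ x ∷ []) ⟩
  T + 2 * (x + x)   ≤⟨ +-monoʳ-≤ T (*-monoʳ-≤ 2 x+x≤s) ⟩
  T + 2 * s         ∎)
  where open ≤-Reasoning

jump-lowers : ∀ {T} x s → T + 4 * x ≡ 3 * s + 1 → s < x + x → T < s
jump-lowers {T} x s e s<x+x = +-cancelʳ-≤ (suc (2 * s)) (suc T) s (begin
  suc T + suc (2 * s)  ≡⟨ solve (T ∷ s ∷ []) ⟩
  T + 2 * suc s        ≤⟨ +-monoʳ-≤ T (*-monoʳ-≤ 2 s<x+x) ⟩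
  T + 2 * (x + x)      ≡⟨ solve (T ∷ x ∷ []) ⟩
  T + 4 * x            ≡⟨ e ⟩
  3 * s + 1            ≡⟨ solve (s ∷ []) ⟩
  s + suc (2 * s)      ∎)
  where open ≤-Reasoning

jumps-ordered : ∀ {T T′ N} x x′ → T + 4 * x ≡ N → T′ + 4 * x′ ≡ N → x < x′ → T′ < T
jumps-ordered {T} {T′} x x′ e e′ x<x′ =
  +-cancelʳ-< (4 * x) T′ T (subst (T′ + 4 * x <_) (trans e′ (sym e)) (+-monoʳ-< T′ (*-monoʳ-< 4 x<x′)))

-- Sorted games

fair-x₁≡x₂⇒x₁≡0 : ∀ {a c} → Fair ⟨ a , a , c ⟩ → a ≡ 0
fair-x₁≡x₂⇒x₁≡0 {a} {c} f =
  m+n≡0⇒m≡0 a (n≤0⇒n≡0 (+-cancelˡ-≤ (c * (2 * (a + a) + 1) + 4 * (a * a)) _ _ (begin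
  (c * (2 * (a + a) + 1) + 4 * (a * a)) + (a + a)  ≡⟨ solve (a ∷ c ∷ []) ⟩
  c * (2 * (a + a) + 1) + (a + a + 4 * (a * a))    ≡⟨ sym (to (fair⇔quadratic c a a) f′) ⟩
  c * c + (a + a) * (a + a)                        ≤⟨ +-monoˡ-≤ _ (*-monoʳ-≤ c (fair⇒root≤ f′)) ⟩
  c * (2 * (a + a) + 1) + (a + a) * (a + a)        ≡⟨ solve (a ∷ c ∷ []) ⟩
  (c * (2 * (a + a) + 1) + 4 * (a * a)) + 0        ∎)))
  where
  open ≤-Reasoning
  f′ = fair-perm p312 f

sorted-fair⇒x₁<x₂ : ∀ {a b c} → a ≤ b → Fair ⟨ a , b , c ⟩ → 2 ≤ a + b + c → a < b
sorted-fair⇒x₁<x₂ a≤b f nt with m≤n⇒m<n∨m≡n a≤b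
... | inj₁ a<b = a<b
... | inj₂ refl with fair-x₁≡x₂⇒x₁≡0 f
...   | refl = ⊥-elim (1+n≰n (≤-trans nt (fair⇒root≤ (fair-perm p312 f))))

fair⇒sum-of-squares : ∀ {a b c} → Fair ⟨ a , b , c ⟩ →
                      2 * (a * a + b * b + c * c) ≡ (a + b + c) * (a + b + c) + (a + b + c)
fair⇒sum-of-squares {a} {b} {c} f = +-cancelʳ-≡ (4 * (a * b + a * c + b * c)) _ _ (begin
  2 * (a * a + b * b + c * c) + 4 * (a * b + a * c + b * c)
    ≡⟨ solve (a ∷ b ∷ c ∷ []) ⟩
  (a + b + c) * (a + b + c) + (a + b + c) * (a + b + c)
    ≡⟨ cong ((a + b + c) * (a + b + c) +_) (equation f) ⟩
  (a + b + c) * (a + b + c) + (a + b + c + 4 * (a * b + a * c + b * c))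
    ≡⟨ solve (a ∷ b ∷ c ∷ []) ⟩
  (a + b + c) * (a + b + c) + (a + b + c) + 4 * (a * b + a * c + b * c)
    ∎)
  where open ≡-Reasoning

-- With c ≤ a + b the sum of squares, i.e. (s² + s)/2, would be at most c·s ≤ s²/2.
sorted-fair⇒x₁+x₂<x₃ : ∀ {a b c} → Sorted ⟨ a , b , c ⟩ → Fair ⟨ a , b , c ⟩ → 2 ≤ a + b + c →
                       a + b < c
sorted-fair⇒x₁+x₂<x₃ {a} {b} {c} (a≤b , b≤c) f nt = ≰⇒> λ c≤a+b →
  1+n≰n (≤-trans (≤-trans (n≤1+n 1) nt) (+-cancelˡ-≤ _ _ 0 (bound c≤a+b)))
  where
  open ≤-Reasoning
  bound : c ≤ a + b → (a + b + c) * (a + b + c) + (a + b + c) ≤ (a + b + c) * (a + b + c) + 0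
  bound c≤a+b = begin
    (a + b + c) * (a + b + c) + (a + b + c)  ≡⟨ sym (fair⇒sum-of-squares f) ⟩
    2 * (a * a + b * b + c * c)              ≤⟨ *-monoʳ-≤ 2 (+-mono-≤ (+-mono-≤ (*-monoˡ-≤ a (≤-trans a≤b b≤c))
                                                                                (*-monoˡ-≤ b b≤c)) ≤-refl) ⟩
    2 * (c * a + c * b + c * c)              ≡⟨ solve (a ∷ b ∷ c ∷ []) ⟩
    (c + c) * (a + b + c)                    ≤⟨ *-monoˡ-≤ (a + b + c) (+-monoˡ-≤ c c≤a+b) ⟩
    (a + b + c) * (a + b + c)                ≡⟨ sym (+-identityʳ _) ⟩
    (a + b + c) * (a + b + c) + 0            ∎

≐⇒≡ : ∀ {g h} → g ≐ h → g ≡ h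
≐⇒≡ {game t (s₁ , s₂) f n} {game .t (s₁′ , s₂′) f′ n′} refl
  rewrite ≤-irrelevant s₁ s₁′ | ≤-irrelevant s₂ s₂′ | ≡-irrelevant f f′ | ≤-irrelevant n n′ = refl

game-fair : (g : Game) → Fair (triple g)
game-fair g = mkFair (fair g)

sortGame : (t : Triple) → Fair t → 2 ≤ tsum t → Game
sortGame t f n with sort t
... | u , p , sorted = game u sorted (equation (fair-perm p f)) (subst (2 ≤_) (tsum-perm p) n)

sortGame-perm : ∀ t f n → Perm t (triple (sortGame t f n))
sortGame-perm t f n with sort t
... | _ , p , _ = p

jumpGame : ∀ i g → 2 ≤ tsum (jump i (triple g)) → Game
jumpGame i g = sortGame (jump i (triple g)) (jump-fair i (game-fair g))

Adj⇒jump : ∀ g h → Adj g h → ∃[ i ] Perm (triple h) (jump i (triple g))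
Adj⇒jump g h (u , p , d) with DiffOne⇒jump (game-fair g) (fair-perm p (game-fair h)) d
... | i , refl = i , p

jumpGame-perm : ∀ i g n → Perm (jump i (triple g)) (triple (jumpGame i g n))
jumpGame-perm i g = sortGame-perm (jump i (triple g)) (jump-fair i (game-fair g))

jumpGame-Adj : ∀ i g n → Adj g (jumpGame i g n)
jumpGame-Adj i g n = _ , perm-sym (jumpGame-perm i g n) , jump-DiffOne i (game-fair g)

jumpGame-tsum : ∀ i g n → tsum (triple (jumpGame i g n)) ≡ tsum (jump i (triple g))
jumpGame-tsum i g n = sym (tsum-perm (jumpGame-perm i g n))

jumpGame-unique : ∀ i g n h → Perm (triple h) (jump i (triple g)) → h ≐ jumpGame i g n
jumpGame-unique i g n h p =
  sorted-unique (perm-trans p (jumpGame-perm i g n)) (sorted h) (sorted (jumpGame i g n))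

jump-first-raises : ∀ g → tsum (triple g) < tsum (jump first (triple g))
jump-first-raises g@(game ⟨ a , b , c ⟩ (a≤b , _) _ _) =
  jump-raises a (a + b + c) (jump-tsum first (game-fair g))
              (≤-trans (+-monoʳ-≤ a a≤b) (m≤m+n (a + b) c))

jump-second-raises : ∀ g → tsum (triple g) < tsum (jump second (triple g))
jump-second-raises g@(game ⟨ a , b , c ⟩ (_ , b≤c) _ _) =
  jump-raises b (a + b + c) (jump-tsum second (game-fair g))
              (≤-trans (+-monoʳ-≤ b b≤c) (≤-trans (m≤n+m (b + c) a) (≤-reflexive (sym (+-assoc a b c)))))

jump-third-lowers : ∀ g → tsum (jump third (triple g)) < tsum (triple g)
jump-third-lowers g@(game ⟨ a , b , c ⟩ ord _ n) =
  jump-lowers c (a + b + c) (jump-tsum third (game-fair g))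
              (+-monoˡ-< c (sorted-fair⇒x₁+x₂<x₃ ord (game-fair g) n))

jump-second<jump-first : ∀ g → tsum (jump second (triple g)) < tsum (jump first (triple g))
jump-second<jump-first g@(game ⟨ a , b , c ⟩ (a≤b , _) _ n) =
  jumps-ordered a b (jump-tsum first (game-fair g)) (jump-tsum second (game-fair g))
                (sorted-fair⇒x₁<x₂ a≤b (game-fair g) n)

jump-third-trivial⇒root : ∀ g → tsum (jump third (triple g)) < 2 → triple g ≡ root-triple
jump-third-trivial⇒root g@(game ⟨ a , b , c ⟩ (a≤b , _) _ n) (s≤s small) =
  root-shape (sorted-fair⇒x₁<x₂ a≤b (game-fair g) n) (vieta+x (fair-perm p312 (game-fair g))) small
  where
  root-shape : ∀ {a b c y} → a < b → y + c ≡ 2 * (a + b) + 1 → a + b + y ≤ 1 →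
               ⟨ a , b , c ⟩ ≡ root-triple
  root-shape {0} {1} {.3} {0} _ refl _ = refl
  root-shape {0} {1} {_} {suc _} _ _ (s≤s ())
  root-shape {0} {suc (suc _)} _ _ (s≤s ())
  root-shape {suc a} {b} {_} {y} a<b _ small =
    ⊥-elim (1+n≰n (≤-trans (≤-trans (s≤s (s≤s z≤n)) a<b)
                           (≤-trans (m≤n+m b (suc a)) (≤-trans (m≤m+n _ y) small))))

jump-above : ∀ g i h → Perm (triple h) (jump i (triple g)) →
             tsum (triple g) < tsum (jump i (triple g)) → hgt g < hgt h
jump-above g i h q lt = s≤s (subst (tsum (triple g) <_) (sym (tsum-perm q)) lt)

jump-below : ∀ g i h → Perm (triple h) (jump i (triple g)) →
             tsum (jump i (triple g)) < tsum (triple g) → hgt h < hgt g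
jump-below g i h q lt = s≤s (subst (_< tsum (triple g)) (sym (tsum-perm q)) lt)

IsParent⇒jump-third : ∀ g p → IsParent g p → Perm (triple p) (jump third (triple g))
IsParent⇒jump-third g p (adj , p<g) with Adj⇒jump g p adj
... | first  , q = ⊥-elim (<-asym p<g (jump-above g first p q (jump-first-raises g)))
... | second , q = ⊥-elim (<-asym p<g (jump-above g second p q (jump-second-raises g)))
... | third  , q = q

IsChild⇒jump : ∀ g c → IsChild g c →
               Perm (triple c) (jump first (triple g)) ⊎ Perm (triple c) (jump second (triple g))
IsChild⇒jump g c (adj , g<c) with Adj⇒jump g c adj
... | first  , q = inj₁ q
... | second , q = inj₂ q
... | third  , q = ⊥-elim (<-asym g<c (jump-below g third c q (jump-third-lowers g)))

Adj-changes-hgt : ∀ {g h} → Adj g h → hgt g < hgt h ⊎ hgt h < hgt g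
Adj-changes-hgt {g} {h} adj with Adj⇒jump g h adj
... | first  , q = inj₁ (jump-above g first h q (jump-first-raises g))
... | second , q = inj₁ (jump-above g second h q (jump-second-raises g))
... | third  , q = inj₂ (jump-below g third h q (jump-third-lowers g))

parent-unique : ∀ {g p q} → IsParent g p → IsParent g q → p ≐ q
parent-unique {g} {p} {q} gp gq =
  sorted-unique (perm-trans (IsParent⇒jump-third g p gp) (perm-sym (IsParent⇒jump-third g q gq)))
                (sorted p) (sorted q)

jumpGame-IsChild : ∀ i g (raises : tsum (triple g) < tsum (jump i (triple g))) →
                   IsChild g (jumpGame i g (≤-trans (nontrivial g) (<⇒≤ raises)))
jumpGame-IsChild i g raises =
  jumpGame-Adj i g n , jump-above g i (jumpGame i g n) (perm-sym (jumpGame-perm i g n)) raises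
  where n = ≤-trans (nontrivial g) (<⇒≤ raises)

children : ∀ g → ∃[ c₁ ] ∃[ c₂ ] (IsChild g c₁ × IsChild g c₂ × ¬ (c₁ ≐ c₂)
                 × (∀ c → IsChild g c → (c ≐ c₁) ⊎ (c ≐ c₂)))
children g = jumpGame first g n₁ , jumpGame second g n₂
           , jumpGame-IsChild first g (jump-first-raises g)
           , jumpGame-IsChild second g (jump-second-raises g)
           , c₁≢c₂
           , λ c c-child → [ inj₁ ∘′ jumpGame-unique first g n₁ c
                           , inj₂ ∘′ jumpGame-unique second g n₂ c ]′ (IsChild⇒jump g c c-child)
  where
  n₁ = ≤-trans (nontrivial g) (<⇒≤ (jump-first-raises g))
  n₂ = ≤-trans (nontrivial g) (<⇒≤ (jump-second-raises g))
  c₁≢c₂ : ¬ (jumpGame first g n₁ ≐ jumpGame second g n₂)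
  c₁≢c₂ c₁≐c₂ = <-irrefl (cong tsum (sym c₁≐c₂))
    (subst₂ _<_ (sym (jumpGame-tsum second g n₂)) (sym (jumpGame-tsum first g n₁))
                (jump-second<jump-first g))

parent-or-root : ∀ g → triple g ≡ root-triple ⊎ ∃ (IsParent g)
parent-or-root g with 2 ≤? tsum (jump third (triple g))
... | yes n  = inj₂ (jumpGame third g n , jumpGame-Adj third g n
                    , jump-below g third (jumpGame third g n) (perm-sym (jumpGame-perm third g n))
                                 (jump-third-lowers g))
... | no 2≰n = inj₁ (jump-third-trivial⇒root g (≰⇒> 2≰n))

parent : ∀ g → ¬ (triple g ≡ root-triple) → ∃[ p ] (IsParent g p × (∀ q → IsParent g q → q ≐ p))
parent g ¬root with parent-or-root g
... | inj₁ isRoot  = ⊥-elim (¬root isRoot)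
... | inj₂ (p , gp) = p , gp , λ q gq → parent-unique {g} {q} {p} gq gp

root : Game
root = game root-triple (z≤n , s≤s z≤n) refl (s≤s (s≤s z≤n))

root-has-no-parent : ∀ q → ¬ IsParent root q
root-has-no-parent q rq with subst (2 ≤_) (tsum-perm (IsParent⇒jump-third root q rq)) (nontrivial q)
... | s≤s ()

open Graded Adj hgt (λ {g} {h} → TAdj-sym {triple g} {triple h})

connected : Connected
connected = Connectivity.connected root (λ g → [ inj₁ ∘′ ≐⇒≡ , inj₂ ]′ (parent-or-root g))

acyclic : Acyclic
acyclic v vs (len , distinct , walk) =
  Acyclicity.no-cycle _≐_ sym (λ {g} {h} → Adj-changes-hgt {g} {h})
                      (λ {g} {p} {q} → parent-unique {g} {p} {q}) len distinct walk

theorem4p10 : IsTree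
    × (∀ g → ∃[ c₁ ] ∃[ c₂ ] (IsChild g c₁ × IsChild g c₂ × ¬ (c₁ ≐ c₂)
                 × (∀ c → IsChild g c → (c ≐ c₁) ⊎ (c ≐ c₂))))
    × (∀ g → ¬ (triple g ≡ root-triple)
           → ∃[ p ] (IsParent g p × (∀ q → IsParent g q → q ≐ p)))
    × (∃[ r ] (triple r ≡ root-triple × (∀ q → ¬ IsParent r q)))
theorem4p10 = (connected , acyclic) , children , parent , (root , refl , root-has-no-parent)
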